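{- For every integer $n\ge0$ and every $\beta\in\mathbb{C}$, with $G_n^{\beta}=U_nE^{n\beta}U_n^{ -1}$ (a linear map on polynomials of degree at most $n$), one has $$G_n^{ -\beta}=J_nG_n^{\beta}J_n .$$
   Context: Polynomials over $\mathbb{C}$. $U_n$ is the linear map on polynomials of degree at most $n$ with $U_nx^p=\frac{(1-x)^{n+1}}{n!}\sum_{m\ge0}m^px^m$ ($0^0=1$), inverse $U_n^{ -1}x^p=(x)_p[x+1]_{n-p}$, where $(y)_p=y(y-1)\cdots(y-p+1)$, $[y]_k=y(y+1)\cdots(y+k-1)$. $E^{\gamma}$ is the shift $c(x)\mapsto c(x+\gamma)$. $J_nc(x)=x^nc(1/x)$. -}

module Defs where

open import Algebra.Bundles using (CommutativeRing)
open import Data.Nat using (ℕ; zero; suc; _∸_; _!)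
open import Data.Nat.Combinatorics using (_C_)
open import Data.Fin using (Fin; toℕ; opposite)
open import Function using (_∘_)

-- Everything is done over an arbitrary commutative ring R (the paper: ℂ).
-- Polynomials are coefficient sequences; a polynomial of degree ≤ n is a
-- coefficient vector  Fin (suc n) → Carrier  (entry k = coefficient of x^k).
-- The parameter  inv  is meant to be a multiplicative inverse of natural
-- numbers (used only for 1/n!); its correctness is a hypothesis of the theorem.
module Poly {c ℓ} (R : CommutativeRing c ℓ) (inv : ℕ → CommutativeRing.Carrier R) where
  open CommutativeRing R

  ι : ℕ → Carrier
  ι zero    = 0#
  ι (suc m) = 1# + ι m

  pow : Carrier → ℕ → Carrier
  pow x zero    = 1#
  pow x (suc m) = x * pow x m

  sumℕ : ℕ → (ℕ → Carrier) → Carrier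
  sumℕ zero    f = 0#
  sumℕ (suc m) f = sumℕ m f + f m

  Σfin : ∀ {n} → (Fin n → Carrier) → Carrier
  Σfin {zero}  f = 0#
  Σfin {suc n} f = f Fin.zero + Σfin (f ∘ Fin.suc)

  Seq : Set c
  Seq = ℕ → Carrier

  _⊛_ : Seq → Seq → Seq
  (a ⊛ b) k = sumℕ (suc k) (λ i → a i * b (k ∸ i))

  one : Seq
  one zero    = 1#
  one (suc _) = 0#

  linX : Carrier → Seq
  linX a zero          = a
  linX a (suc zero)    = 1#
  linX a (suc (suc _)) = 0#

  prodSeq : ℕ → (ℕ → Seq) → Seq
  prodSeq zero    f = one
  prodSeq (suc m) f = prodSeq m f ⊛ f m

  falling : ℕ → Seq
  falling p = prodSeq p (λ i → linX (- ι i))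

  rising1 : ℕ → Seq
  rising1 k = prodSeq k (λ i → linX (ι (suc i)))

  P : ℕ → Set c
  P n = Fin (suc n) → Carrier

  -- U_n^{-1} x^p = (x)_p [x+1]_{n-p}, extended linearly
  Uinv : (n : ℕ) → P n → P n
  Uinv n a k = Σfin (λ p → a p * (falling (toℕ p) ⊛ rising1 (n ∸ toℕ p)) (toℕ k))

  -- coefficient of x^k (k ≤ n) in  (1-x)^{n+1}/n! Σ_{m≥0} m^p x^m :
  --   (1/n!) Σ_{j=0}^{k} (-1)^j C(n+1,j) (k-j)^p
  UBasis : ℕ → ℕ → ℕ → Carrier
  UBasis n p k = inv (n !) * sumℕ (suc k) (λ j → (pow (- 1#) j * ι (suc n C j)) * pow (ι (k ∸ j)) p)

  U : (n : ℕ) → P n → P n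
  U n a k = Σfin (λ p → a p * UBasis n (toℕ p) (toℕ k))

  -- shift E^γ : c(x) ↦ c(x+γ);  coefficient of x^k is Σ_p c_p C(p,k) γ^{p-k}
  E : (n : ℕ) → Carrier → P n → P n
  E n γ a k = Σfin (λ p → a p * (ι (toℕ p C toℕ k) * pow γ (toℕ p ∸ toℕ k)))

  -- J_n c(x) = x^n c(1/x)
  J : (n : ℕ) → P n → P n
  J n a k = a (opposite k)

  G : (n : ℕ) → Carrier → P n → P n
  G n β = U n ∘ E n (ι n * β) ∘ Uinv n

-- Evaluation turns U_n into a finite-difference operator: the k-th coefficient of U_n b is
-- (1/n!) Σ_{j ≤ k} (-1)^j C(n+1,j) b(k - j), the coefficients of (1 - x)^(n+1) against
-- the values of b.  E^γ shifts the argument, and U_n^{-1} a is the function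
-- F_a(t) = Σ_p a_p (t)_p [t+1]_{n-p}, so the k-th coefficient of G_n^β a is such an
-- alternating sum of the values F_a(k - j + nβ).  As F_a has degree n, the full sum over
-- 0 ≤ j ≤ n + 1 is Δ^{n+1} F_a = 0; hence the first k + 1 terms are minus the last
-- n - k + 1, and by the symmetry of the binomial coefficients these are, read backwards,
-- the terms for n - k evaluated at the reflected points -1 - t.  Finally
-- (-1-t)_p = (-1)^p [t+1]_p gives F_a(-1-t) = (-1)^n F_{J_n a}(t), which turns nβ into
-- -nβ and k into n - k.

module Submission where

open import Algebra.Bundles using (CommutativeRing; Ring)
open import Algebra.Solver.Ring.AlmostCommutativeRing
  using (AlmostCommutativeRing; fromCommutativeRing; _-Raw-AlmostCommutative⟶_)
open import Data.Fin as Fin using (Fin; toℕ; opposite; inject₁; fromℕ)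
open import Data.Fin.Properties using (toℕ≤pred[n]; opposite-prop; opposite-involutive)
open import Data.Integer as ℤ using (ℤ; +_; -[1+_])
import Data.Integer.Properties as ℤ
open import Data.Maybe using (Maybe; just; nothing)
open import Data.Nat as ℕ using (ℕ; zero; suc; _∸_; _!)
open import Data.Nat.Combinatorics using (_C_; nCk+nC[k+1]≡[n+1]C[k+1]; k>n⇒nCk≡0; nCk≡nC[n∸k])
import Data.Nat.Properties as ℕ
open import Function using (_∘_)
open import Level using (_⊔_)
open import Relation.Nullary using (yes; no)
open import Relation.Binary.PropositionalEquality as ≡ using (_≡_)
open import Defs

module IntegerCoefficientSolver {c ℓ} (R : CommutativeRing c ℓ) where
  open CommutativeRing R
  open import Algebra.Properties.Ring ring using (-‿involutive; -0#≈0#; -‿distribˡ-*; -‿distribʳ-*; -‿+-comm)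
  open import Algebra.Properties.CommutativeSemigroup +-commutativeSemigroup using (interchange)
  open import Relation.Binary.Reasoning.Setoid setoid

  private
    -- Unlike Poly.ι, this sends 1 to 1# on the nose, so that solver
    -- constants such as  con (+ 1)  denote 1# definitionally.
    fromNat : ℕ → Carrier
    fromNat zero          = 0#
    fromNat (suc zero)    = 1#
    fromNat (suc (suc n)) = 1# + fromNat (suc n)

    fromNat-suc : ∀ n → fromNat (suc n) ≈ 1# + fromNat n
    fromNat-suc zero    = sym (+-identityʳ 1#)
    fromNat-suc (suc n) = refl

    fromNat-+ : ∀ m n → fromNat (m ℕ.+ n) ≈ fromNat m + fromNat n
    fromNat-+ zero    n = sym (+-identityˡ _)
    fromNat-+ (suc m) n = begin
      fromNat (suc (m ℕ.+ n))        ≈⟨ fromNat-suc (m ℕ.+ n) ⟩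
      1# + fromNat (m ℕ.+ n)         ≈⟨ +-congˡ (fromNat-+ m n) ⟩
      1# + (fromNat m + fromNat n)     ≈⟨ sym (+-assoc _ _ _) ⟩
      (1# + fromNat m) + fromNat n     ≈⟨ +-congʳ (sym (fromNat-suc m)) ⟩
      fromNat (suc m) + fromNat n      ∎

    fromNat-* : ∀ m n → fromNat (m ℕ.* n) ≈ fromNat m * fromNat n
    fromNat-* zero    n = sym (zeroˡ _)
    fromNat-* (suc m) n = begin
      fromNat (n ℕ.+ m ℕ.* n)            ≈⟨ fromNat-+ n (m ℕ.* n) ⟩
      fromNat n + fromNat (m ℕ.* n)        ≈⟨ +-cong (sym (*-identityˡ _)) (fromNat-* m n) ⟩
      1# * fromNat n + fromNat m * fromNat n ≈⟨ sym (distribʳ _ _ _) ⟩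
      (1# + fromNat m) * fromNat n         ≈⟨ *-congʳ (sym (fromNat-suc m)) ⟩
      fromNat (suc m) * fromNat n          ∎

    fromInt : ℤ → Carrier
    fromInt (+ n)      = fromNat n
    fromInt -[1+ n ]  = - fromNat (suc n)

    fromInt-neg : ∀ i → fromInt (ℤ.- i) ≈ - fromInt i
    fromInt-neg (+ zero)  = sym -0#≈0#
    fromInt-neg (+ suc n) = refl
    fromInt-neg -[1+ n ]  = sym (-‿involutive _)

    fromInt-⊖ : ∀ m n → fromInt (m ℤ.⊖ n) ≈ fromNat m - fromNat n
    fromInt-⊖ m       zero    = sym (trans (+-congˡ -0#≈0#) (+-identityʳ _))
    fromInt-⊖ zero    (suc n) = sym (+-identityˡ _)
    fromInt-⊖ (suc m) (suc n) = begin
      fromInt (suc m ℤ.⊖ suc n)                 ≡⟨ ≡.cong fromInt (ℤ.[1+m]⊖[1+n]≡m⊖n m n) ⟩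
      fromInt (m ℤ.⊖ n)                         ≈⟨ fromInt-⊖ m n ⟩
      fromNat m - fromNat n                   ≈⟨ sym (+-identityˡ _) ⟩
      0# + (fromNat m - fromNat n)            ≈⟨ +-congʳ (sym (-‿inverseʳ 1#)) ⟩
      (1# - 1#) + (fromNat m - fromNat n)     ≈⟨ interchange _ _ _ _ ⟩
      (1# + fromNat m) + (- 1# - fromNat n)   ≈⟨ +-cong (sym (fromNat-suc m)) (-‿+-comm 1# (fromNat n)) ⟩
      fromNat (suc m) - (1# + fromNat n)      ≈⟨ +-congˡ (-‿cong (sym (fromNat-suc n))) ⟩
      fromNat (suc m) - fromNat (suc n)       ∎

    fromInt-+ : ∀ i j → fromInt (i ℤ.+ j) ≈ fromInt i + fromInt j
    fromInt-+ (+ m)    (+ n)    = fromNat-+ m n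
    fromInt-+ (+ m)    -[1+ n ] = fromInt-⊖ m (suc n)
    fromInt-+ -[1+ m ] (+ n)    = trans (fromInt-⊖ n (suc m)) (+-comm _ _)
    fromInt-+ -[1+ m ] -[1+ n ] = begin
      - fromNat (suc (suc (m ℕ.+ n)))       ≡⟨ ≡.cong (λ k → - fromNat (suc k)) (≡.sym (ℕ.+-suc m n)) ⟩
      - fromNat (suc m ℕ.+ suc n)           ≈⟨ -‿cong (fromNat-+ (suc m) (suc n)) ⟩
      - (fromNat (suc m) + fromNat (suc n))   ≈⟨ sym (-‿+-comm _ _) ⟩
      - fromNat (suc m) - fromNat (suc n)     ∎

    fromInt-* : ∀ i j → fromInt (i ℤ.* j) ≈ fromInt i * fromInt j
    fromInt-* (+ m) (+ n) = trans (reflexive (≡.cong fromInt (≡.sym (ℤ.pos-* m n)))) (fromNat-* m n)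
    fromInt-* (+ m) -[1+ n ] = begin
      fromInt (+ m ℤ.* ℤ.- + suc n)             ≡⟨ ≡.cong fromInt (≡.sym (ℤ.neg-distribʳ-* (+ m) (+ suc n))) ⟩
      fromInt (ℤ.- (+ m ℤ.* + suc n))           ≈⟨ fromInt-neg (+ m ℤ.* + suc n) ⟩
      - fromInt (+ m ℤ.* + suc n)               ≈⟨ -‿cong (fromInt-* (+ m) (+ suc n)) ⟩
      - (fromNat m * fromNat (suc n))         ≈⟨ -‿distribʳ-* _ _ ⟩
      fromNat m * - fromNat (suc n)           ∎
    fromInt-* -[1+ m ] (+ n) = begin
      fromInt (ℤ.- + suc m ℤ.* + n)             ≡⟨ ≡.cong fromInt (≡.sym (ℤ.neg-distribˡ-* (+ suc m) (+ n))) ⟩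
      fromInt (ℤ.- (+ suc m ℤ.* + n))           ≈⟨ fromInt-neg (+ suc m ℤ.* + n) ⟩
      - fromInt (+ suc m ℤ.* + n)               ≈⟨ -‿cong (fromInt-* (+ suc m) (+ n)) ⟩
      - (fromNat (suc m) * fromNat n)         ≈⟨ -‿distribˡ-* _ _ ⟩
      - fromNat (suc m) * fromNat n           ∎
    fromInt-* -[1+ m ] -[1+ n ] = begin
      fromInt (+ suc m ℤ.* + suc n)             ≈⟨ fromInt-* (+ suc m) (+ suc n) ⟩
      fromNat (suc m) * fromNat (suc n)       ≈⟨ sym (*-cong (-‿involutive _) refl) ⟩
      - - fromNat (suc m) * fromNat (suc n)   ≈⟨ sym (-‿distribˡ-* _ _) ⟩
      - (- fromNat (suc m) * fromNat (suc n)) ≈⟨ -‿distribʳ-* _ _ ⟩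
      - fromNat (suc m) * - fromNat (suc n)   ∎

    homomorphism : Ring.rawRing ℤ.+-*-ring -Raw-AlmostCommutative⟶ fromCommutativeRing R
    homomorphism = record
      { ⟦_⟧    = fromInt
      ; +-homo = fromInt-+
      ; *-homo = fromInt-*
      ; -‿homo = fromInt-neg
      ; 0-homo = refl
      ; 1-homo = refl
      }

    decideEquality : ∀ i j → Maybe (fromInt i ≈ fromInt j)
    decideEquality i j with i ℤ.≟ j
    ... | yes ≡.refl = just refl
    ... | no _       = nothing

  open import Algebra.Solver.Ring (Ring.rawRing ℤ.+-*-ring) (fromCommutativeRing R) homomorphism decideEquality public

module _ {c ℓ} (R : CommutativeRing c ℓ) (inv : ℕ → CommutativeRing.Carrier R) where
  open CommutativeRing R hiding (zero)
  open Poly R inv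
  open IntegerCoefficientSolver R
  open import Algebra.Properties.Ring ring using (-0#≈0#; -1*x≈-x)
  open import Algebra.Properties.CommutativeSemigroup +-commutativeSemigroup using (interchange)
  open import Algebra.Properties.CommutativeSemigroup *-commutativeSemigroup
    using () renaming (x∙yz≈y∙xz to x*yz≈y*xz; xy∙z≈y∙xz to xy*z≈y*xz)
  open import Relation.Binary.Reasoning.Setoid setoid

  -- Finite sums

  sumℕ-cong : ∀ m {f g : ℕ → Carrier} → (∀ i → f i ≈ g i) → sumℕ m f ≈ sumℕ m g
  sumℕ-cong zero    f≈g = refl
  sumℕ-cong (suc m) f≈g = +-cong (sumℕ-cong m f≈g) (f≈g m)

  sumℕ-cong-< : ∀ m {f g : ℕ → Carrier} → (∀ i → i ℕ.< m → f i ≈ g i) → sumℕ m f ≈ sumℕ m g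
  sumℕ-cong-< zero    f≈g = refl
  sumℕ-cong-< (suc m) f≈g = +-cong (sumℕ-cong-< m (λ i i<m → f≈g i (ℕ.m<n⇒m<1+n i<m))) (f≈g m (ℕ.n<1+n m))

  sumℕ-+ : ∀ m f g → sumℕ m (λ i → f i + g i) ≈ sumℕ m f + sumℕ m g
  sumℕ-+ zero    f g = sym (+-identityˡ _)
  sumℕ-+ (suc m) f g = trans (+-congʳ (sumℕ-+ m f g)) (interchange _ _ _ _)

  sumℕ-*ˡ : ∀ m x f → sumℕ m (λ i → x * f i) ≈ x * sumℕ m f
  sumℕ-*ˡ zero    x f = sym (zeroʳ x)
  sumℕ-*ˡ (suc m) x f = trans (+-congʳ (sumℕ-*ˡ m x f)) (sym (distribˡ x _ _))

  sumℕ-zero : ∀ m {f} → (∀ i → i ℕ.< m → f i ≈ 0#) → sumℕ m f ≈ 0#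
  sumℕ-zero zero    f≈0 = refl
  sumℕ-zero (suc m) f≈0 =
    trans (+-cong (sumℕ-zero m (λ i i<m → f≈0 i (ℕ.m<n⇒m<1+n i<m))) (f≈0 m (ℕ.n<1+n m))) (+-identityˡ _)

  sumℕ-head : ∀ m f → sumℕ (suc m) f ≈ f 0 + sumℕ m (f ∘ suc)
  sumℕ-head zero    f = +-comm _ _
  sumℕ-head (suc m) f = trans (+-congʳ (sumℕ-head m f)) (+-assoc _ _ _)

  sumℕ-split : ∀ m k f → sumℕ (m ℕ.+ k) f ≈ sumℕ m f + sumℕ k (λ i → f (m ℕ.+ i))
  sumℕ-split m zero    f = trans (reflexive (≡.cong (λ z → sumℕ z f) (ℕ.+-identityʳ m))) (sym (+-identityʳ _))
  sumℕ-split m (suc k) f = begin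
    sumℕ (m ℕ.+ suc k) f                                           ≡⟨ ≡.cong (λ z → sumℕ z f) (ℕ.+-suc m k) ⟩
    sumℕ (m ℕ.+ k) f + f (m ℕ.+ k)                                 ≈⟨ +-congʳ (sumℕ-split m k f) ⟩
    (sumℕ m f + sumℕ k (λ i → f (m ℕ.+ i))) + f (m ℕ.+ k)          ≈⟨ +-assoc _ _ _ ⟩
    sumℕ m f + sumℕ (suc k) (λ i → f (m ℕ.+ i))                    ∎

  sumℕ-reverse : ∀ m f → sumℕ m f ≈ sumℕ m (λ i → f (m ∸ suc i))
  sumℕ-reverse zero    f = refl
  sumℕ-reverse (suc m) f = begin
    sumℕ m f + f m                             ≈⟨ +-comm _ _ ⟩
    f m + sumℕ m f                             ≈⟨ +-congˡ (sumℕ-reverse m f) ⟩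
    f m + sumℕ m (λ i → f (m ∸ suc i))         ≈⟨ sym (sumℕ-head m (λ i → f (suc m ∸ suc i))) ⟩
    sumℕ (suc m) (λ i → f (suc m ∸ suc i))     ∎

  sumℕ-extend : ∀ m k f → (∀ i → m ℕ.≤ i → f i ≈ 0#) → sumℕ (m ℕ.+ k) f ≈ sumℕ m f
  sumℕ-extend m k f f≈0 = begin
    sumℕ (m ℕ.+ k) f                           ≈⟨ sumℕ-split m k f ⟩
    sumℕ m f + sumℕ k (λ i → f (m ℕ.+ i))      ≈⟨ +-congˡ (sumℕ-zero k (λ i _ → f≈0 (m ℕ.+ i) (ℕ.m≤m+n m i))) ⟩
    sumℕ m f + 0#                              ≈⟨ +-identityʳ _ ⟩
    sumℕ m f                                   ∎

  Σfin-cong : ∀ {n} {f g : Fin n → Carrier} → (∀ i → f i ≈ g i) → Σfin f ≈ Σfin g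
  Σfin-cong {zero}  f≈g = refl
  Σfin-cong {suc n} f≈g = +-cong (f≈g Fin.zero) (Σfin-cong (f≈g ∘ Fin.suc))

  Σfin-+ : ∀ {n} (f g : Fin n → Carrier) → Σfin (λ i → f i + g i) ≈ Σfin f + Σfin g
  Σfin-+ {zero}  f g = sym (+-identityˡ _)
  Σfin-+ {suc n} f g = trans (+-congˡ (Σfin-+ (f ∘ Fin.suc) (g ∘ Fin.suc))) (interchange _ _ _ _)

  Σfin-*ˡ : ∀ {n} x (f : Fin n → Carrier) → Σfin (λ i → x * f i) ≈ x * Σfin f
  Σfin-*ˡ {zero}  x f = sym (zeroʳ x)
  Σfin-*ˡ {suc n} x f = trans (+-congˡ (Σfin-*ˡ x (f ∘ Fin.suc))) (sym (distribˡ x _ _))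

  Σfin-*ʳ : ∀ {n} x (f : Fin n → Carrier) → Σfin (λ i → f i * x) ≈ Σfin f * x
  Σfin-*ʳ x f = trans (Σfin-cong (λ i → *-comm (f i) x)) (trans (Σfin-*ˡ x f) (*-comm _ _))

  Σfin-zero : ∀ {n} (f : Fin n → Carrier) → (∀ i → f i ≈ 0#) → Σfin f ≈ 0#
  Σfin-zero {zero}  f f≈0 = refl
  Σfin-zero {suc n} f f≈0 = trans (+-cong (f≈0 Fin.zero) (Σfin-zero (f ∘ Fin.suc) (f≈0 ∘ Fin.suc))) (+-identityˡ _)

  Σfin-toℕ : ∀ m g → Σfin {m} (g ∘ toℕ) ≈ sumℕ m g
  Σfin-toℕ zero    g = refl
  Σfin-toℕ (suc m) g = trans (+-congˡ (Σfin-toℕ m (g ∘ suc))) (sym (sumℕ-head m g))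

  Σfin-sumℕ : ∀ {n} m (f : Fin n → ℕ → Carrier) →
    Σfin (λ p → sumℕ m (f p)) ≈ sumℕ m (λ j → Σfin (λ p → f p j))
  Σfin-sumℕ {n} zero    f = Σfin-zero {n} _ (λ _ → refl)
  Σfin-sumℕ     (suc m) f = trans (Σfin-+ (λ p → sumℕ m (f p)) (λ p → f p m)) (+-congʳ (Σfin-sumℕ m f))

  Σfin-swap : ∀ {n m} (f : Fin n → Fin m → Carrier) → Σfin (λ p → Σfin (f p)) ≈ Σfin (λ k → Σfin (λ p → f p k))
  Σfin-swap {zero}  {m} f = sym (Σfin-zero {m} _ (λ _ → refl))
  Σfin-swap {suc n} {m} f = trans (+-congˡ (Σfin-swap (f ∘ Fin.suc))) (sym (Σfin-+ (f Fin.zero) _))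

  Σfin-last : ∀ {n} (f : Fin (suc n) → Carrier) → Σfin f ≈ Σfin (f ∘ inject₁) + f (fromℕ n)
  Σfin-last {zero}  f = +-comm _ _
  Σfin-last {suc n} f = trans (+-congˡ (Σfin-last (f ∘ Fin.suc))) (sym (+-assoc _ _ _))

  Σfin-opposite : ∀ {n} (f : Fin n → Carrier) → Σfin (f ∘ opposite) ≈ Σfin f
  Σfin-opposite {zero}  f = refl
  Σfin-opposite {suc n} f = trans (+-congˡ (Σfin-opposite (f ∘ inject₁))) (trans (+-comm _ _) (sym (Σfin-last f)))

  -- The binomial theorem

  ι-+ : ∀ m n → ι (m ℕ.+ n) ≈ ι m + ι n
  ι-+ zero    n = sym (+-identityˡ _)
  ι-+ (suc m) n = trans (+-congˡ (ι-+ m n)) (sym (+-assoc _ _ _))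

  ι-∸ : ∀ {m n} → n ℕ.≤ m → ι (m ∸ n) ≈ ι m - ι n
  ι-∸ {m} {n} n≤m = begin
    ι (m ∸ n)                   ≈⟨ solve 2 (λ x y → x := (x :+ y) :- y) refl (ι (m ∸ n)) (ι n) ⟩
    (ι (m ∸ n) + ι n) - ι n     ≈⟨ +-congʳ (sym (ι-+ (m ∸ n) n)) ⟩
    ι (m ∸ n ℕ.+ n) - ι n       ≡⟨ ≡.cong (λ k → ι k - ι n) (ℕ.m∸n+n≡m n≤m) ⟩
    ι m - ι n                   ∎

  pow-+ : ∀ x m n → pow x (m ℕ.+ n) ≈ pow x m * pow x n
  pow-+ x zero    n = sym (*-identityˡ _)
  pow-+ x (suc m) n = trans (*-congˡ (pow-+ x m n)) (sym (*-assoc _ _ _))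

  sgn : ℕ → Carrier
  sgn = pow (- 1#)

  sgn-+ : ∀ m n → sgn (m ℕ.+ n) ≈ sgn m * sgn n
  sgn-+ = pow-+ (- 1#)

  sgn*sgn : ∀ m → sgn m * sgn m ≈ 1#
  sgn*sgn zero    = *-identityˡ _
  sgn*sgn (suc m) = trans (solve 1 (λ s → (:- con (+ 1) :* s) :* (:- con (+ 1) :* s) := s :* s) refl (sgn m)) (sgn*sgn m)

  sumℕ-pascal : ∀ m (w : ℕ → Carrier) →
    sumℕ (suc (suc m)) (λ j → ι (suc m C j) * w j)
      ≈ sumℕ (suc m) (λ j → ι (m C j) * w j) + sumℕ (suc m) (λ j → ι (m C j) * w (suc j))
  sumℕ-pascal m w = begin
    sumℕ (suc (suc m)) (λ j → ι (suc m C j) * w j)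
      ≈⟨ sumℕ-head (suc m) _ ⟩
    ι (suc m C 0) * w 0 + sumℕ (suc m) (λ j → ι (suc m C suc j) * w (suc j))
      ≈⟨ +-congˡ (trans (sumℕ-cong (suc m) split-coeff) (sumℕ-+ (suc m) _ _)) ⟩
    ι (suc m C 0) * w 0 + (shifted + (rest + ι (m C suc m) * w (suc m)))
      ≈⟨ +-congˡ (+-congˡ (+-congˡ (trans (*-congʳ (reflexive (≡.cong ι (k>n⇒nCk≡0 (ℕ.n<1+n m))))) (zeroˡ _)))) ⟩
    ι (suc m C 0) * w 0 + (shifted + (rest + 0#))
      ≈⟨ solve 3 (λ x b s → x :+ (b :+ (s :+ con (+ 0))) := (x :+ s) :+ b) refl _ shifted rest ⟩
    (ι (m C 0) * w 0 + rest) + shifted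
      ≈⟨ +-congʳ (sym (sumℕ-head m (λ j → ι (m C j) * w j))) ⟩
    sumℕ (suc m) (λ j → ι (m C j) * w j) + shifted ∎
    where
    shifted = sumℕ (suc m) (λ j → ι (m C j) * w (suc j))
    rest    = sumℕ m (λ j → ι (m C suc j) * w (suc j))
    split-coeff : ∀ j → ι (suc m C suc j) * w (suc j) ≈ ι (m C j) * w (suc j) + ι (m C suc j) * w (suc j)
    split-coeff j = trans (*-congʳ (trans (reflexive (≡.cong ι (≡.sym (nCk+nC[k+1]≡[n+1]C[k+1] m j))))
                                          (ι-+ (m C j) (m C suc j))))
                          (distribʳ _ _ _)

  binomial : ∀ m t γ → sumℕ (suc m) (λ k → ι (m C k) * (pow γ (m ∸ k) * pow t k)) ≈ pow (t + γ) m
  binomial zero    t γ = solve 0 (con (+ 0) :+ (con (+ 1) :+ con (+ 0)) :* (con (+ 1) :* con (+ 1)) := con (+ 1)) refl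
  binomial (suc m) t γ = begin
    sumℕ (suc (suc m)) (λ k → ι (suc m C k) * w k)
      ≈⟨ sumℕ-pascal m w ⟩
    sumℕ (suc m) (λ k → ι (m C k) * w k) + sumℕ (suc m) (λ k → ι (m C k) * w (suc k))
      ≈⟨ +-cong (sumℕ-cong-< (suc m) lower) (sumℕ-cong (suc m) upper) ⟩
    sumℕ (suc m) (λ k → γ * b k) + sumℕ (suc m) (λ k → t * b k)
      ≈⟨ +-cong (sumℕ-*ˡ (suc m) γ b) (sumℕ-*ˡ (suc m) t b) ⟩
    γ * sumℕ (suc m) b + t * sumℕ (suc m) b
      ≈⟨ +-cong (*-congˡ (binomial m t γ)) (*-congˡ (binomial m t γ)) ⟩
    γ * pow (t + γ) m + t * pow (t + γ) m
      ≈⟨ solve 3 (λ g x y → g :* y :+ x :* y := (x :+ g) :* y) refl γ t _ ⟩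
    pow (t + γ) (suc m) ∎
    where
    w b : ℕ → Carrier
    w k = pow γ (suc m ∸ k) * pow t k
    b k = ι (m C k) * (pow γ (m ∸ k) * pow t k)
    lower : ∀ k → k ℕ.< suc m → ι (m C k) * w k ≈ γ * b k
    lower k (ℕ.s≤s k≤m) = trans (*-congˡ (*-congʳ (reflexive (≡.cong (pow γ) (ℕ.+-∸-assoc 1 k≤m)))))
       (solve 4 (λ c g x y → c :* ((g :* x) :* y) := g :* (c :* (x :* y))) refl _ γ _ _)
    upper : ∀ k → ι (m C k) * w (suc k) ≈ t * b k
    upper k = solve 4 (λ c x s y → c :* (x :* (s :* y)) := s :* (c :* (x :* y))) refl _ _ t _

  binomial-≤ : ∀ n m t γ → m ℕ.≤ n → sumℕ (suc n) (λ k → ι (m C k) * (pow γ (m ∸ k) * pow t k)) ≈ pow (t + γ) m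
  binomial-≤ n m t γ m≤n = begin
    sumℕ (suc n) f                  ≡⟨ ≡.cong (λ z → sumℕ (suc z) f) (≡.sym (ℕ.m+[n∸m]≡n m≤n)) ⟩
    sumℕ (suc m ℕ.+ (n ∸ m)) f      ≈⟨ sumℕ-extend (suc m) (n ∸ m) f beyond-m ⟩
    sumℕ (suc m) f                  ≈⟨ binomial m t γ ⟩
    pow (t + γ) m                   ∎
    where
    f = λ k → ι (m C k) * (pow γ (m ∸ k) * pow t k)
    beyond-m : ∀ i → suc m ℕ.≤ i → f i ≈ 0#
    beyond-m i m<i = trans (*-congʳ (reflexive (≡.cong ι (k>n⇒nCk≡0 m<i)))) (zeroˡ _)

  -- Evaluation of polynomials, the shift E and the map U

  ev : ∀ {n} → P n → Carrier → Carrier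
  ev a t = Σfin (λ p → a p * pow t (toℕ p))

  evSeq : ℕ → Seq → Carrier → Carrier
  evSeq N s t = sumℕ N (λ k → s k * pow t k)

  ev-Σfin : ∀ n (a : P n) (M : Fin (suc n) → Seq) t →
    ev {n} (λ k → Σfin (λ p → a p * M p (toℕ k))) t ≈ Σfin (λ p → a p * evSeq (suc n) (M p) t)
  ev-Σfin n a M t = begin
    Σfin {suc n} (λ k → Σfin (λ p → a p * M p (toℕ k)) * pow t (toℕ k))
      ≈⟨ Σfin-cong {suc n} (λ k → sym (Σfin-*ʳ (pow t (toℕ k)) (λ p → a p * M p (toℕ k)))) ⟩
    Σfin {suc n} (λ k → Σfin (λ p → a p * M p (toℕ k) * pow t (toℕ k)))
      ≈⟨ sym (Σfin-swap {suc n} {suc n} (λ p k → a p * M p (toℕ k) * pow t (toℕ k))) ⟩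
    Σfin (λ p → Σfin {suc n} (λ k → a p * M p (toℕ k) * pow t (toℕ k)))
      ≈⟨ Σfin-cong (λ p → trans (Σfin-cong {suc n} (λ k → *-assoc (a p) (M p (toℕ k)) (pow t (toℕ k))))
                                (Σfin-*ˡ {suc n} (a p) (λ k → M p (toℕ k) * pow t (toℕ k)))) ⟩
    Σfin (λ p → a p * Σfin {suc n} (λ k → M p (toℕ k) * pow t (toℕ k)))
      ≈⟨ Σfin-cong (λ p → *-congˡ {a p} (Σfin-toℕ (suc n) (λ k → M p k * pow t k))) ⟩
    Σfin (λ p → a p * evSeq (suc n) (M p) t) ∎

  ev-E : ∀ n γ (a : P n) t → ev (E n γ a) t ≈ ev a (t + γ)
  ev-E n γ a t = trans (ev-Σfin n a (λ p k → ι (toℕ p C k) * pow γ (toℕ p ∸ k)) t)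
                       (Σfin-cong (λ p → *-congˡ {a p} (binomial-at (toℕ p) (toℕ≤pred[n] p))))
    where
    binomial-at : ∀ m → m ℕ.≤ n → evSeq (suc n) (λ k → ι (m C k) * pow γ (m ∸ k)) t ≈ pow (t + γ) m
    binomial-at m m≤n = trans (sumℕ-cong (suc n) (λ k → *-assoc _ _ _)) (binomial-≤ n m t γ m≤n)

  diffCoeff : ℕ → ℕ → Carrier
  diffCoeff n j = sgn j * ι (suc n C j)

  U-as-diffCoeff-sum : ∀ n (a : P n) k →
    U n a k ≈ inv (n !) * sumℕ (suc (toℕ k)) (λ j → diffCoeff n j * ev a (ι (toℕ k ∸ j)))
  U-as-diffCoeff-sum n a k = begin
    Σfin (λ p → a p * (n!⁻¹ * sumℕ (suc K) (term p)))
      ≈⟨ Σfin-cong (λ p → x*yz≈y*xz (a p) n!⁻¹ (sumℕ (suc K) (term p))) ⟩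
    Σfin (λ p → n!⁻¹ * (a p * sumℕ (suc K) (term p)))
      ≈⟨ Σfin-*ˡ n!⁻¹ (λ p → a p * sumℕ (suc K) (term p)) ⟩
    n!⁻¹ * Σfin (λ p → a p * sumℕ (suc K) (term p))
      ≈⟨ *-congˡ (Σfin-cong (λ p → trans (sym (sumℕ-*ˡ (suc K) (a p) (term p))) (sumℕ-cong (suc K) (reorder p)))) ⟩
    n!⁻¹ * Σfin (λ p → sumℕ (suc K) (λ j → diffCoeff n j * (a p * pow (x j) (toℕ p))))
      ≈⟨ *-congˡ (Σfin-sumℕ (suc K) (λ p j → diffCoeff n j * (a p * pow (x j) (toℕ p)))) ⟩
    n!⁻¹ * sumℕ (suc K) (λ j → Σfin (λ p → diffCoeff n j * (a p * pow (x j) (toℕ p))))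
      ≈⟨ *-congˡ (sumℕ-cong (suc K) (λ j → Σfin-*ˡ (diffCoeff n j) (λ p → a p * pow (x j) (toℕ p)))) ⟩
    n!⁻¹ * sumℕ (suc K) (λ j → diffCoeff n j * ev a (x j)) ∎
    where
    n!⁻¹ = inv (n !)
    K = toℕ k
    x : ℕ → Carrier
    x j = ι (K ∸ j)
    term : Fin (suc n) → ℕ → Carrier
    term p j = diffCoeff n j * pow (x j) (toℕ p)
    reorder : ∀ p j → a p * term p j ≈ diffCoeff n j * (a p * pow (x j) (toℕ p))
    reorder p j = x*yz≈y*xz (a p) (diffCoeff n j) (pow (x j) (toℕ p))

  -- Products of linear factors as coefficient sequences

  timesX : Seq → Seq
  timesX s zero    = 0#
  timesX s (suc k) = s k

  ⊛-congʳ : ∀ s {r r′ : Seq} → (∀ j → r j ≈ r′ j) → ∀ k → (s ⊛ r) k ≈ (s ⊛ r′) k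
  ⊛-congʳ s r≈r′ k = sumℕ-cong (suc k) (λ i → *-congˡ (r≈r′ (k ∸ i)))

  ⊛-distribˡ-+ : ∀ s r q k → (s ⊛ (λ j → r j + q j)) k ≈ (s ⊛ r) k + (s ⊛ q) k
  ⊛-distribˡ-+ s r q k = trans (sumℕ-cong (suc k) (λ i → distribˡ (s i) _ _)) (sumℕ-+ (suc k) _ _)

  ⊛-*ʳ : ∀ s r x k → (s ⊛ (λ j → r j * x)) k ≈ (s ⊛ r) k * x
  ⊛-*ʳ s r x k = begin
    sumℕ (suc k) (λ i → s i * (r (k ∸ i) * x))
      ≈⟨ sumℕ-cong (suc k) (λ i → solve 3 (λ a b c → a :* (b :* c) := c :* (a :* b)) refl (s i) (r (k ∸ i)) x) ⟩
    sumℕ (suc k) (λ i → x * (s i * r (k ∸ i)))  ≈⟨ sumℕ-*ˡ (suc k) x _ ⟩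
    x * (s ⊛ r) k                               ≈⟨ *-comm _ _ ⟩
    (s ⊛ r) k * x                               ∎

  ⊛-timesX : ∀ s r k → (s ⊛ timesX r) k ≈ timesX (s ⊛ r) k
  ⊛-timesX s r zero    = trans (+-identityˡ _) (zeroʳ _)
  ⊛-timesX s r (suc k) = begin
    sumℕ (suc k) (λ i → s i * timesX r (suc k ∸ i)) + s (suc k) * timesX r (k ∸ k)
      ≈⟨ +-cong (sumℕ-cong-< (suc k) (λ { i (ℕ.s≤s i≤k) →
                  *-congˡ (reflexive (≡.cong (timesX r) (ℕ.+-∸-assoc 1 i≤k))) }))
                (trans (*-congˡ (reflexive (≡.cong (timesX r) (ℕ.n∸n≡0 k)))) (zeroʳ _)) ⟩
    (s ⊛ r) k + 0#
      ≈⟨ +-identityʳ _ ⟩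
    (s ⊛ r) k ∎

  linX-vanishes : ∀ x k i → i ℕ.< k → linX x (suc k ∸ i) ≡ 0#
  linX-vanishes x (suc k) zero    _           = ≡.refl
  linX-vanishes x (suc k) (suc i) (ℕ.s≤s i<k) = linX-vanishes x k i i<k

  one-vanishes : ∀ k i → i ℕ.< k → one (k ∸ i) ≡ 0#
  one-vanishes (suc k) zero    _           = ≡.refl
  one-vanishes (suc k) (suc i) (ℕ.s≤s i<k) = one-vanishes k i i<k

  ⊛-linX : ∀ s x k → (s ⊛ linX x) k ≈ s k * x + timesX s k
  ⊛-linX s x zero    = trans (+-identityˡ _) (sym (+-identityʳ _))
  ⊛-linX s x (suc k) = begin
    (sumℕ k f + f k) + f (suc k)
      ≈⟨ +-cong (+-cong (sumℕ-zero k (λ i i<k → trans (*-congˡ (reflexive (linX-vanishes x k i i<k))) (zeroʳ _)))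
                        (*-congˡ (reflexive (≡.cong (linX x) (ℕ.m+n∸n≡m 1 k)))))
                (*-congˡ (reflexive (≡.cong (linX x) (ℕ.n∸n≡0 k)))) ⟩
    (0# + s k * 1#) + s (suc k) * x
      ≈⟨ solve 2 (λ a b → (con (+ 0) :+ a :* con (+ 1)) :+ b := b :+ a) refl (s k) (s (suc k) * x) ⟩
    s (suc k) * x + s k ∎
    where
    f = λ i → s i * linX x (suc k ∸ i)

  ⊛-one : ∀ s k → (s ⊛ one) k ≈ s k
  ⊛-one s k = begin
    sumℕ k (λ i → s i * one (k ∸ i)) + s k * one (k ∸ k)
      ≈⟨ +-cong (sumℕ-zero k (λ i i<k → trans (*-congˡ (reflexive (one-vanishes k i i<k))) (zeroʳ _)))
                (*-congˡ (reflexive (≡.cong one (ℕ.n∸n≡0 k)))) ⟩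
    0# + s k * 1#
      ≈⟨ trans (+-identityˡ _) (*-identityʳ _) ⟩
    s k ∎

  ⊛-linX-assoc : ∀ s r x k → (s ⊛ (r ⊛ linX x)) k ≈ ((s ⊛ r) ⊛ linX x) k
  ⊛-linX-assoc s r x k = begin
    (s ⊛ (r ⊛ linX x)) k                    ≈⟨ ⊛-congʳ s (⊛-linX r x) k ⟩
    (s ⊛ (λ j → r j * x + timesX r j)) k    ≈⟨ ⊛-distribˡ-+ s (λ j → r j * x) (timesX r) k ⟩
    (s ⊛ (λ j → r j * x)) k + (s ⊛ timesX r) k ≈⟨ +-cong (⊛-*ʳ s r x k) (⊛-timesX s r k) ⟩
    (s ⊛ r) k * x + timesX (s ⊛ r) k         ≈⟨ sym (⊛-linX (s ⊛ r) x k) ⟩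
    ((s ⊛ r) ⊛ linX x) k                    ∎

  Deg≤ : ℕ → Seq → Set ℓ
  Deg≤ d s = ∀ k → d ℕ.< k → s k ≈ 0#

  Deg≤-cong : ∀ {d} {s s′ : Seq} → (∀ k → s k ≈ s′ k) → Deg≤ d s → Deg≤ d s′
  Deg≤-cong s≈s′ deg k d<k = trans (sym (s≈s′ k)) (deg k d<k)

  Deg≤-one : Deg≤ 0 one
  Deg≤-one (suc k) _ = refl

  Deg≤-⊛-linX : ∀ {d s} x → Deg≤ d s → Deg≤ (suc d) (s ⊛ linX x)
  Deg≤-⊛-linX {s = s} x deg (suc k) (ℕ.s≤s d<k) = begin
    (s ⊛ linX x) (suc k)    ≈⟨ ⊛-linX s x (suc k) ⟩
    s (suc k) * x + s k     ≈⟨ +-cong (*-congʳ (deg (suc k) (ℕ.m<n⇒m<1+n d<k))) (deg k d<k) ⟩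
    0# * x + 0#             ≈⟨ trans (+-identityʳ _) (zeroˡ x) ⟩
    0#                      ∎

  evSeq-⊛-linX : ∀ N {d s} x t → Deg≤ d s → suc d ℕ.< N → evSeq N (s ⊛ linX x) t ≈ evSeq N s t * (t + x)
  evSeq-⊛-linX (suc N) {s = s} x t deg (ℕ.s≤s d<N) = begin
    evSeq (suc N) (s ⊛ linX x) t
      ≈⟨ sumℕ-cong (suc N) (λ k → trans (*-congʳ (⊛-linX s x k)) (distribʳ _ _ _)) ⟩
    sumℕ (suc N) (λ k → s k * x * pow t k + timesX s k * pow t k)
      ≈⟨ sumℕ-+ (suc N) _ _ ⟩
    sumℕ (suc N) (λ k → s k * x * pow t k) + sumℕ (suc N) (λ k → timesX s k * pow t k)
      ≈⟨ +-cong (trans (sumℕ-cong (suc N) (λ k → solve 3 (λ a c y → a :* c :* y := c :* (a :* y)) refl (s k) x (pow t k)))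
                       (sumℕ-*ˡ (suc N) x _))
                (sumℕ-head N _) ⟩
    x * evSeq (suc N) s t + (0# * 1# + sumℕ N (λ k → s k * (t * pow t k)))
      ≈⟨ +-cong (*-congˡ top-vanishes)
                (+-congˡ (trans (sumℕ-cong N (λ k → x*yz≈y*xz (s k) t (pow t k)))
                                (sumℕ-*ˡ N t _))) ⟩
    x * evSeq N s t + (0# * 1# + t * evSeq N s t)
      ≈⟨ solve 3 (λ c e s → c :* e :+ (con (+ 0) :* con (+ 1) :+ s :* e) := e :* (s :+ c)) refl x (evSeq N s t) t ⟩
    evSeq N s t * (t + x)
      ≈⟨ *-congʳ (sym top-vanishes) ⟩
    evSeq (suc N) s t * (t + x) ∎
    where
    top-vanishes : evSeq (suc N) s t ≈ evSeq N s t
    top-vanishes = trans (+-congˡ (trans (*-congʳ (deg N d<N)) (zeroˡ _))) (+-identityʳ _)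

  prodLin : ℕ → (ℕ → Carrier) → Carrier → Carrier
  prodLin zero    f t = 1#
  prodLin (suc m) f t = prodLin m f t * (t + f m)

  prodLinX : ℕ → (ℕ → Carrier) → Seq
  prodLinX m f = prodSeq m (linX ∘ f)

  Deg≤-prodLinX : ∀ m f → Deg≤ m (prodLinX m f)
  Deg≤-prodLinX zero    f = Deg≤-one
  Deg≤-prodLinX (suc m) f = Deg≤-⊛-linX (f m) (Deg≤-prodLinX m f)

  evSeq-prodLinX : ∀ m f N t → m ℕ.< N → evSeq N (prodLinX m f) t ≈ prodLin m f t
  evSeq-prodLinX zero    f (suc N) t _ = begin
    evSeq (suc N) one t
      ≈⟨ sumℕ-head N _ ⟩
    one 0 * pow t 0 + sumℕ N (λ k → one (suc k) * pow t (suc k))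
      ≈⟨ +-cong (*-identityˡ _) (sumℕ-zero N (λ k _ → zeroˡ _)) ⟩
    1# + 0#
      ≈⟨ +-identityʳ _ ⟩
    1# ∎
  evSeq-prodLinX (suc m) f N t m<N = begin
    evSeq N (prodLinX m f ⊛ linX (f m)) t
      ≈⟨ evSeq-⊛-linX N (f m) t (Deg≤-prodLinX m f) m<N ⟩
    evSeq N (prodLinX m f) t * (t + f m)
      ≈⟨ *-congʳ (evSeq-prodLinX m f N t (ℕ.<-trans (ℕ.n<1+n m) m<N)) ⟩
    prodLin (suc m) f t ∎

  evSeq-cong : ∀ N {s s′ : Seq} t → (∀ k → s k ≈ s′ k) → evSeq N s t ≈ evSeq N s′ t
  evSeq-cong N t s≈s′ = sumℕ-cong N (λ k → *-congʳ (s≈s′ k))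

  Deg≤-⊛-prodLinX : ∀ m f {d s} → Deg≤ d s → Deg≤ (d ℕ.+ m) (s ⊛ prodLinX m f)
  Deg≤-⊛-prodLinX zero    f {d} {s} deg =
    Deg≤-cong (λ k → sym (⊛-one s k)) (≡.subst (λ e → Deg≤ e s) (≡.sym (ℕ.+-identityʳ d)) deg)
  Deg≤-⊛-prodLinX (suc m) f {d} {s} deg =
    Deg≤-cong (λ k → sym (⊛-linX-assoc s (prodLinX m f) (f m) k))
      (≡.subst (λ e → Deg≤ e ((s ⊛ prodLinX m f) ⊛ linX (f m))) (≡.sym (ℕ.+-suc d m))
        (Deg≤-⊛-linX (f m) (Deg≤-⊛-prodLinX m f deg)))

  evSeq-⊛-prodLinX : ∀ m f N t {d s} → Deg≤ d s → d ℕ.+ m ℕ.< N →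
    evSeq N (s ⊛ prodLinX m f) t ≈ evSeq N s t * prodLin m f t
  evSeq-⊛-prodLinX zero    f N t {s = s} deg _ =
    trans (evSeq-cong N t (⊛-one s)) (sym (*-identityʳ _))
  evSeq-⊛-prodLinX (suc m) f N t {d} {s} deg d+m<N = begin
    evSeq N (s ⊛ (prodLinX m f ⊛ linX (f m))) t
      ≈⟨ evSeq-cong N t (⊛-linX-assoc s (prodLinX m f) (f m)) ⟩
    evSeq N ((s ⊛ prodLinX m f) ⊛ linX (f m)) t
      ≈⟨ evSeq-⊛-linX N (f m) t (Deg≤-⊛-prodLinX m f deg) d+m<N′ ⟩
    evSeq N (s ⊛ prodLinX m f) t * (t + f m)
      ≈⟨ *-congʳ (evSeq-⊛-prodLinX m f N t deg (ℕ.<-trans (ℕ.n<1+n _) d+m<N′)) ⟩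
    (evSeq N s t * prodLin m f t) * (t + f m)
      ≈⟨ *-assoc _ _ _ ⟩
    evSeq N s t * prodLin (suc m) f t ∎
    where
    d+m<N′ : suc (d ℕ.+ m) ℕ.< N
    d+m<N′ = ≡.subst (ℕ._< N) (ℕ.+-suc d m) d+m<N

  evSeq-prodLinX-⊛-prodLinX : ∀ m f m′ f′ N t → m ℕ.+ m′ ℕ.< N →
    evSeq N (prodLinX m f ⊛ prodLinX m′ f′) t ≈ prodLin m f t * prodLin m′ f′ t
  evSeq-prodLinX-⊛-prodLinX m f m′ f′ N t m+m′<N = begin
    evSeq N (prodLinX m f ⊛ prodLinX m′ f′) t
      ≈⟨ evSeq-⊛-prodLinX m′ f′ N t (Deg≤-prodLinX m f) m+m′<N ⟩
    evSeq N (prodLinX m f) t * prodLin m′ f′ t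
      ≈⟨ *-congʳ (evSeq-prodLinX m f N t (ℕ.≤-<-trans (ℕ.m≤m+n m m′) m+m′<N)) ⟩
    prodLin m f t * prodLin m′ f′ t ∎

  fallingShift risingShift : ℕ → Carrier
  fallingShift i = - ι i
  risingShift  i = ι (suc i)

  uinvBasis : ℕ → ℕ → Carrier → Carrier
  uinvBasis n p t = prodLin p fallingShift t * prodLin (n ∸ p) risingShift t

  uinvValue : ∀ n → P n → Carrier → Carrier
  uinvValue n a t = Σfin (λ p → a p * uinvBasis n (toℕ p) t)

  ev-Uinv : ∀ n (a : P n) t → ev (Uinv n a) t ≈ uinvValue n a t
  ev-Uinv n a t = trans (ev-Σfin n a Q t) (Σfin-cong (λ p → *-congˡ {a p} (evSeq-Q p)))
    where
    Q : Fin (suc n) → Seq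
    Q p = falling (toℕ p) ⊛ rising1 (n ∸ toℕ p)
    evSeq-Q : ∀ p → evSeq (suc n) (Q p) t ≈ uinvBasis n (toℕ p) t
    evSeq-Q p = evSeq-prodLinX-⊛-prodLinX (toℕ p) fallingShift (n ∸ toℕ p) risingShift (suc n) t
      (≡.subst (ℕ._< suc n) (≡.sym (ℕ.m+[n∸m]≡n (toℕ≤pred[n] p))) (ℕ.n<1+n n))

  reflect : Carrier → Carrier
  reflect t = - (1# + t)

  prodLin-fallingShift-reflect : ∀ m t → prodLin m fallingShift (reflect t) ≈ sgn m * prodLin m risingShift t
  prodLin-fallingShift-reflect zero    t = sym (*-identityˡ _)
  prodLin-fallingShift-reflect (suc m) t = trans (*-congʳ (prodLin-fallingShift-reflect m t))
    (solve 4 (λ s r x i → (s :* r) :* (:- (con (+ 1) :+ x) :+ :- i) := (:- con (+ 1) :* s) :* (r :* (x :+ (con (+ 1) :+ i))))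
           refl (sgn m) (prodLin m risingShift t) t (ι m))

  prodLin-risingShift-reflect : ∀ m t → prodLin m risingShift (reflect t) ≈ sgn m * prodLin m fallingShift t
  prodLin-risingShift-reflect zero    t = sym (*-identityˡ _)
  prodLin-risingShift-reflect (suc m) t = trans (*-congʳ (prodLin-risingShift-reflect m t))
    (solve 4 (λ s f x i → (s :* f) :* (:- (con (+ 1) :+ x) :+ (con (+ 1) :+ i)) := (:- con (+ 1) :* s) :* (f :* (x :+ :- i)))
           refl (sgn m) (prodLin m fallingShift t) t (ι m))

  uinvBasis-reflect : ∀ n p t → p ℕ.≤ n → uinvBasis n (n ∸ p) t ≈ sgn n * uinvBasis n p (reflect t)
  uinvBasis-reflect n p t p≤n = begin
    prodLin (n ∸ p) fallingShift t * prodLin (n ∸ (n ∸ p)) risingShift t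
      ≡⟨ ≡.cong (λ e → prodLin (n ∸ p) fallingShift t * prodLin e risingShift t) (ℕ.m∸[m∸n]≡n p≤n) ⟩
    Fₜ * Rₜ
      ≈⟨ sym (trans (*-congʳ (sgn*sgn n)) (*-identityˡ _)) ⟩
    (sgn n * sgn n) * (Fₜ * Rₜ)
      ≈⟨ *-congʳ (*-congˡ (trans (reflexive (≡.cong sgn (≡.sym (ℕ.m+[n∸m]≡n p≤n)))) (sgn-+ p (n ∸ p)))) ⟩
    (sgn n * (sgn p * sgn (n ∸ p))) * (Fₜ * Rₜ)
      ≈⟨ solve 5 (λ s a b f r → (s :* (a :* b)) :* (f :* r) := s :* ((a :* r) :* (b :* f)))
                 refl (sgn n) (sgn p) (sgn (n ∸ p)) Fₜ Rₜ ⟩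
    sgn n * ((sgn p * Rₜ) * (sgn (n ∸ p) * Fₜ))
      ≈⟨ *-congˡ (sym (*-cong (prodLin-fallingShift-reflect p t) (prodLin-risingShift-reflect (n ∸ p) t))) ⟩
    sgn n * uinvBasis n p (reflect t) ∎
    where
    Fₜ = prodLin (n ∸ p) fallingShift t
    Rₜ = prodLin p risingShift t

  uinvValue-J : ∀ n (a : P n) t → uinvValue n (J n a) t ≈ sgn n * uinvValue n a (reflect t)
  uinvValue-J n a t = begin
    Σfin (λ p → a (opposite p) * uinvBasis n (toℕ p) t)
      ≈⟨ sym (Σfin-opposite (λ p → a (opposite p) * uinvBasis n (toℕ p) t)) ⟩
    Σfin (λ p → a (opposite (opposite p)) * uinvBasis n (toℕ (opposite p)) t)
      ≈⟨ Σfin-cong (λ p → *-cong (reflexive (≡.cong a (opposite-involutive p)))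
                                          (trans (reflexive (≡.cong (λ e → uinvBasis n e t) (opposite-prop p)))
                                                 (uinvBasis-reflect n (toℕ p) t (toℕ≤pred[n] p)))) ⟩
    Σfin (λ p → a p * (sgn n * uinvBasis n (toℕ p) (reflect t)))
      ≈⟨ Σfin-cong (λ p → x*yz≈y*xz (a p) (sgn n) (uinvBasis n (toℕ p) (reflect t))) ⟩
    Σfin (λ p → sgn n * (a p * uinvBasis n (toℕ p) (reflect t)))
      ≈⟨ Σfin-*ˡ (sgn n) (λ p → a p * uinvBasis n (toℕ p) (reflect t)) ⟩
    sgn n * uinvValue n a (reflect t) ∎

  -- Polynomial functions and backward differences

  data IsPolynomial : ℕ → (Carrier → Carrier) → Set (c ⊔ ℓ) where
    pconst : ∀ {d} a → IsPolynomial d (λ _ → a)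
    padd   : ∀ {d f g} → IsPolynomial d f → IsPolynomial d g → IsPolynomial d (λ t → f t + g t)
    pscale : ∀ {d f} a → IsPolynomial d f → IsPolynomial d (λ t → a * f t)
    plin   : ∀ {d f} a → IsPolynomial d f → IsPolynomial (suc d) (λ t → (t + a) * f t)
    pext   : ∀ {d f g} → (∀ t → f t ≈ g t) → IsPolynomial d f → IsPolynomial d g

  Congruent : (Carrier → Carrier) → Set (c ⊔ ℓ)
  Congruent f = ∀ {x y} → x ≈ y → f x ≈ f y

  IsPolynomial⇒congruent : ∀ {d f} → IsPolynomial d f → Congruent f
  IsPolynomial⇒congruent (pconst a)   x≈y = refl
  IsPolynomial⇒congruent (padd p q)   x≈y = +-cong (IsPolynomial⇒congruent p x≈y) (IsPolynomial⇒congruent q x≈y)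
  IsPolynomial⇒congruent (pscale a p) x≈y = *-congˡ (IsPolynomial⇒congruent p x≈y)
  IsPolynomial⇒congruent (plin a p)   x≈y = *-cong (+-congʳ x≈y) (IsPolynomial⇒congruent p x≈y)
  IsPolynomial⇒congruent (pext f≈g p) {x} {y} x≈y = trans (sym (f≈g x)) (trans (IsPolynomial⇒congruent p x≈y) (f≈g y))

  IsPolynomial-shift : ∀ {d f} e → IsPolynomial d f → IsPolynomial d (λ t → f (t + e))
  IsPolynomial-shift e (pconst a)   = pconst a
  IsPolynomial-shift e (padd p q)   = padd (IsPolynomial-shift e p) (IsPolynomial-shift e q)
  IsPolynomial-shift e (pscale a p) = pscale a (IsPolynomial-shift e p)
  IsPolynomial-shift e (plin a p)   = pext (λ t → *-congʳ (sym (+-assoc t e a))) (plin (e + a) (IsPolynomial-shift e p))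
  IsPolynomial-shift e (pext f≈g p) = pext (λ t → f≈g (t + e)) (IsPolynomial-shift e p)

  IsPolynomial-prodLin : ∀ m f {d g} → IsPolynomial d g → IsPolynomial (m ℕ.+ d) (λ t → prodLin m f t * g t)
  IsPolynomial-prodLin zero    f p = pext (λ t → sym (*-identityˡ _)) p
  IsPolynomial-prodLin (suc m) f {d} {g} p =
    ≡.subst (λ e → IsPolynomial e (λ t → prodLin (suc m) f t * g t)) (ℕ.+-suc m d)
      (pext (λ t → sym (*-assoc _ _ _)) (IsPolynomial-prodLin m f (plin (f m) p)))

  IsPolynomial-Σfin : ∀ {m d} (h : Fin m → Carrier → Carrier) → (∀ p → IsPolynomial d (h p)) →
    IsPolynomial d (λ t → Σfin (λ p → h p t))
  IsPolynomial-Σfin {zero}  h hp = pconst 0#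
  IsPolynomial-Σfin {suc m} h hp = padd (hp Fin.zero) (IsPolynomial-Σfin (h ∘ Fin.suc) (hp ∘ Fin.suc))

  IsPolynomial-uinvValue : ∀ n (a : P n) → IsPolynomial n (uinvValue n a)
  IsPolynomial-uinvValue n a = IsPolynomial-Σfin (λ p t → a p * uinvBasis n (toℕ p) t) (λ p → pscale (a p) (basis p))
    where
    basis : ∀ p → IsPolynomial n (uinvBasis n (toℕ p))
    basis p = ≡.subst (λ e → IsPolynomial e (uinvBasis n (toℕ p)))
                (≡.trans (≡.cong (toℕ p ℕ.+_) (ℕ.+-identityʳ (n ∸ toℕ p))) (ℕ.m+[n∸m]≡n (toℕ≤pred[n] p)))
                (pext (λ t → *-congˡ (*-identityʳ _))
                  (IsPolynomial-prodLin (toℕ p) fallingShift (IsPolynomial-prodLin (n ∸ toℕ p) risingShift (pconst 1#))))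

  Δ : (Carrier → Carrier) → Carrier → Carrier
  Δ f t = f t - f (t - 1#)

  Δ-cong : ∀ {f} → Congruent f → Congruent (Δ f)
  Δ-cong f-cong x≈y = +-cong (f-cong x≈y) (-‿cong (f-cong (+-congʳ x≈y)))

  Δ-const : ∀ {f} → IsPolynomial 0 f → ∀ t → Δ f t ≈ 0#
  Δ-const (pconst a) t = -‿inverseʳ a
  Δ-const (padd {f = f} {g} p q) t = begin
    (f t + g t) - (f (t - 1#) + g (t - 1#))
      ≈⟨ solve 4 (λ a b x y → (a :+ b) :- (x :+ y) := (a :- x) :+ (b :- y)) refl (f t) (g t) _ _ ⟩
    Δ f t + Δ g t
      ≈⟨ +-cong (Δ-const p t) (Δ-const q t) ⟩
    0# + 0#
      ≈⟨ +-identityˡ _ ⟩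
    0# ∎
  Δ-const (pscale {f = f} a p) t = begin
    a * f t - a * f (t - 1#)  ≈⟨ solve 3 (λ a x y → a :* x :- a :* y := a :* (x :- y)) refl a (f t) _ ⟩
    a * Δ f t                 ≈⟨ *-congˡ (Δ-const p t) ⟩
    a * 0#                    ≈⟨ zeroʳ a ⟩
    0#                        ∎
  Δ-const (pext f≈g p) t = trans (+-cong (sym (f≈g t)) (-‿cong (sym (f≈g (t - 1#))))) (Δ-const p t)

  Δ-linear-factor : ∀ a f t → (t + a) * Δ f t + f (t - 1#) ≈ Δ (λ s → (s + a) * f s) t
  Δ-linear-factor a f t =
    solve 4 (λ s a x y → (s :+ a) :* (x :- y) :+ y := (s :+ a) :* x :- ((s :- con (+ 1)) :+ a) :* y) refl t a (f t) (f (t - 1#))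

  Δ-lowers-degree : ∀ {d f} → IsPolynomial (suc d) f → IsPolynomial d (Δ f)
  Δ-lowers-degree (pconst a) = pext (λ t → sym (-‿inverseʳ a)) (pconst 0#)
  Δ-lowers-degree (padd {f = f} {g} p q) =
    pext (λ t → solve 4 (λ a b x y → (a :- x) :+ (b :- y) := (a :+ b) :- (x :+ y)) refl (f t) (g t) _ _)
      (padd (Δ-lowers-degree p) (Δ-lowers-degree q))
  Δ-lowers-degree (pscale {f = f} a p) =
    pext (λ t → solve 3 (λ a x y → a :* (x :- y) := a :* x :- a :* y) refl a (f t) _) (pscale a (Δ-lowers-degree p))
  Δ-lowers-degree {zero} (plin {f = f} a p) =
    pext (λ t → trans (sym (+-identityˡ _))
                      (trans (+-congʳ (sym (trans (*-congˡ (Δ-const p t)) (zeroʳ _)))) (Δ-linear-factor a f t)))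
      (IsPolynomial-shift (- 1#) p)
  Δ-lowers-degree {suc d} (plin {f = f} a p) =
    pext (Δ-linear-factor a f) (padd (plin a (Δ-lowers-degree p)) (IsPolynomial-shift (- 1#) p))
  Δ-lowers-degree (pext f≈g p) = pext (λ t → +-cong (f≈g t) (-‿cong (f≈g (t - 1#)))) (Δ-lowers-degree p)

  Δⁿ : ℕ → (Carrier → Carrier) → Carrier → Carrier
  Δⁿ zero    f = f
  Δⁿ (suc m) f = Δⁿ m (Δ f)

  Δⁿ-vanishes : ∀ d {f} → IsPolynomial d f → ∀ t → Δⁿ (suc d) f t ≈ 0#
  Δⁿ-vanishes zero    p t = Δ-const p t
  Δⁿ-vanishes (suc d) p t = Δⁿ-vanishes d (Δ-lowers-degree p) t

  Δⁿ-expansion : ∀ m f → Congruent f → ∀ t → Δⁿ m f t ≈ sumℕ (suc m) (λ j → ι (m C j) * (sgn j * f (t - ι j)))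
  Δⁿ-expansion zero f f-cong t = sym (begin
    0# + (1# + 0#) * (1# * f (t - 0#))
      ≈⟨ +-congˡ (*-congˡ (*-congˡ (f-cong (trans (+-congˡ -0#≈0#) (+-identityʳ t))))) ⟩
    0# + (1# + 0#) * (1# * f t)
      ≈⟨ solve 1 (λ x → con (+ 0) :+ (con (+ 1) :+ con (+ 0)) :* (con (+ 1) :* x) := x) refl (f t) ⟩
    f t ∎)
  Δⁿ-expansion (suc m) f f-cong t = begin
    Δⁿ m (Δ f) t
      ≈⟨ Δⁿ-expansion m (Δ f) (Δ-cong f-cong) t ⟩
    sumℕ (suc m) (λ j → ι (m C j) * (sgn j * Δ f (t - ι j)))
      ≈⟨ trans (sumℕ-cong (suc m) split) (sumℕ-+ (suc m) _ _) ⟩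
    sumℕ (suc m) (λ j → ι (m C j) * w j) + sumℕ (suc m) (λ j → ι (m C j) * w (suc j))
      ≈⟨ sym (sumℕ-pascal m w) ⟩
    sumℕ (suc (suc m)) (λ j → ι (suc m C j) * w j) ∎
    where
    w : ℕ → Carrier
    w j = sgn j * f (t - ι j)
    split : ∀ j → ι (m C j) * (sgn j * Δ f (t - ι j)) ≈ ι (m C j) * w j + ι (m C j) * w (suc j)
    split j = trans
      (*-congˡ (*-congˡ (+-congˡ (-‿cong (f-cong (solve 2 (λ s i → (s :- i) :- con (+ 1) := s :- (con (+ 1) :+ i)) refl t (ι j)))))))
      (solve 4 (λ c s x y → c :* (s :* (x :- y)) := c :* (s :* x) :+ c :* ((:- con (+ 1) :* s) :* y))
             refl (ι (m C j)) (sgn j) (f (t - ι j)) (f (t - (1# + ι j))))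

  -- Alternating sums against (1 - x)^(n+1)

  diffCoeff-sum-vanishes : ∀ n {h} → IsPolynomial n h → ∀ x →
    sumℕ (suc (suc n)) (λ j → diffCoeff n j * h (x - ι j)) ≈ 0#
  diffCoeff-sum-vanishes n {h} hp x = begin
    sumℕ (suc (suc n)) (λ j → diffCoeff n j * h (x - ι j))
      ≈⟨ sumℕ-cong (suc (suc n)) (λ j → xy*z≈y*xz (sgn j) (ι (suc n C j)) (h (x - ι j))) ⟩
    sumℕ (suc (suc n)) (λ j → ι (suc n C j) * (sgn j * h (x - ι j)))
      ≈⟨ sym (Δⁿ-expansion (suc n) h (IsPolynomial⇒congruent hp) x) ⟩
    Δⁿ (suc n) h x
      ≈⟨ Δⁿ-vanishes n hp x ⟩
    0# ∎

  diffCoeff-complement : ∀ n i → i ℕ.≤ suc n → diffCoeff n (suc n ∸ i) ≈ - sgn n * diffCoeff n i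
  diffCoeff-complement n i i≤1+n = begin
    sgn (suc n ∸ i) * ι (suc n C (suc n ∸ i))
      ≡⟨ ≡.cong (λ e → sgn (suc n ∸ i) * ι e) (≡.sym (nCk≡nC[n∸k] i≤1+n)) ⟩
    sgn (suc n ∸ i) * ι (suc n C i)
      ≈⟨ *-congʳ sign ⟩
    (- sgn n * sgn i) * ι (suc n C i)
      ≈⟨ *-assoc _ _ _ ⟩
    - sgn n * diffCoeff n i ∎
    where
    sign : sgn (suc n ∸ i) ≈ - sgn n * sgn i
    sign = begin
      sgn (suc n ∸ i)                    ≈⟨ sym (trans (*-congˡ (sgn*sgn i)) (*-identityʳ _)) ⟩
      sgn (suc n ∸ i) * (sgn i * sgn i)  ≈⟨ sym (*-assoc _ _ _) ⟩
      sgn (suc n ∸ i) * sgn i * sgn i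
        ≈⟨ *-congʳ (trans (sym (sgn-+ (suc n ∸ i) i)) (reflexive (≡.cong sgn (ℕ.m∸n+n≡m i≤1+n)))) ⟩
      sgn (suc n) * sgn i                ≈⟨ *-congʳ (-1*x≈-x (sgn n)) ⟩
      - sgn n * sgn i                    ∎

  diffCoeff-sum-reflect : ∀ n {h} → IsPolynomial n h → ∀ K K′ → K ℕ.+ K′ ≡ n →
    sumℕ (suc K) (λ j → diffCoeff n j * h (ι (K ∸ j)))
      ≈ sgn n * sumℕ (suc K′) (λ j → diffCoeff n j * h (reflect (ι (K′ ∸ j))))
  diffCoeff-sum-reflect n {h} hp K K′ K+K′≡n = begin
    front                                   ≈⟨ solve 3 (λ a s b → a := (a :+ (:- s) :* b) :+ s :* b) refl front (sgn n) back ⟩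
    (front + - sgn n * back) + sgn n * back ≈⟨ +-congʳ front-back ⟩
    0# + sgn n * back                       ≈⟨ +-identityˡ _ ⟩
    sgn n * back                            ∎
    where
    h-cong = IsPolynomial⇒congruent hp
    g : ℕ → Carrier
    g j = diffCoeff n j * h (ι K - ι j)
    front = sumℕ (suc K) (λ j → diffCoeff n j * h (ι (K ∸ j)))
    back  = sumℕ (suc K′) (λ j → diffCoeff n j * h (reflect (ι (K′ ∸ j))))

    front≈ : sumℕ (suc K) g ≈ front
    front≈ = sumℕ-cong-< (suc K) (λ { j (ℕ.s≤s j≤K) → *-congˡ (h-cong (sym (ι-∸ j≤K))) })

    back-term : ∀ i → i ℕ.≤ K′ → g (suc K ℕ.+ (K′ ∸ i)) ≈ - sgn n * (diffCoeff n i * h (reflect (ι (K′ ∸ i))))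
    back-term i i≤K′ = begin
      diffCoeff n (suc K ℕ.+ (K′ ∸ i)) * h (ι K - (1# + ι (K ℕ.+ (K′ ∸ i))))
        ≈⟨ *-cong (reflexive (≡.cong (diffCoeff n) index)) (h-cong argument) ⟩
      diffCoeff n (suc n ∸ i) * h (reflect (ι (K′ ∸ i)))
        ≈⟨ *-congʳ (diffCoeff-complement n i (ℕ.m≤n⇒m≤1+n i≤n)) ⟩
      (- sgn n * diffCoeff n i) * h (reflect (ι (K′ ∸ i)))
        ≈⟨ *-assoc _ _ _ ⟩
      - sgn n * (diffCoeff n i * h (reflect (ι (K′ ∸ i)))) ∎
      where
      i≤n : i ℕ.≤ n
      i≤n = ≡.subst (i ℕ.≤_) K+K′≡n (ℕ.≤-trans i≤K′ (ℕ.m≤n+m K′ K))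
      index : suc K ℕ.+ (K′ ∸ i) ≡ suc n ∸ i
      index = ≡.trans (≡.cong suc (≡.trans (≡.sym (ℕ.+-∸-assoc K i≤K′)) (≡.cong (_∸ i) K+K′≡n)))
                      (≡.sym (ℕ.+-∸-assoc 1 i≤n))
      argument : ι K - (1# + ι (K ℕ.+ (K′ ∸ i))) ≈ reflect (ι (K′ ∸ i))
      argument = trans (+-congˡ (-‿cong (+-congˡ (ι-+ K (K′ ∸ i)))))
                       (solve 2 (λ a x → a :- (con (+ 1) :+ (a :+ x)) := :- (con (+ 1) :+ x)) refl (ι K) (ι (K′ ∸ i)))

    back≈ : sumℕ (suc K′) (λ i → g (suc K ℕ.+ i)) ≈ - sgn n * back
    back≈ = begin
      sumℕ (suc K′) (λ i → g (suc K ℕ.+ i))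
        ≈⟨ sumℕ-reverse (suc K′) (λ i → g (suc K ℕ.+ i)) ⟩
      sumℕ (suc K′) (λ i → g (suc K ℕ.+ (K′ ∸ i)))
        ≈⟨ sumℕ-cong-< (suc K′) (λ { i (ℕ.s≤s i≤K′) → back-term i i≤K′ }) ⟩
      sumℕ (suc K′) (λ i → - sgn n * (diffCoeff n i * h (reflect (ι (K′ ∸ i)))))
        ≈⟨ sumℕ-*ˡ (suc K′) (- sgn n) _ ⟩
      - sgn n * back ∎

    front-back : front + - sgn n * back ≈ 0#
    front-back = begin
      front + - sgn n * back                                   ≈⟨ +-cong (sym front≈) (sym back≈) ⟩
      sumℕ (suc K) g + sumℕ (suc K′) (λ i → g (suc K ℕ.+ i))   ≈⟨ sym (sumℕ-split (suc K) (suc K′) g) ⟩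
      sumℕ (suc K ℕ.+ suc K′) g                                ≡⟨ ≡.cong (λ m → sumℕ m g) length ⟩
      sumℕ (suc (suc n)) g                                     ≈⟨ diffCoeff-sum-vanishes n hp (ι K) ⟩
      0#                                                       ∎
      where
      length : suc K ℕ.+ suc K′ ≡ suc (suc n)
      length = ≡.cong suc (≡.trans (ℕ.+-suc K K′) (≡.cong suc K+K′≡n))

  -- The reflection identity

  G-as-diffCoeff-sum : ∀ n β (a : P n) k →
    G n β a k ≈ inv (n !) * sumℕ (suc (toℕ k)) (λ j → diffCoeff n j * uinvValue n a (ι (toℕ k ∸ j) + ι n * β))
  G-as-diffCoeff-sum n β a k = trans (U-as-diffCoeff-sum n (E n (ι n * β) (Uinv n a)) k)
    (*-congˡ (sumℕ-cong (suc (toℕ k)) (λ j → *-congˡ (trans (ev-E n (ι n * β) (Uinv n a) _) (ev-Uinv n a _)))))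

  G-neg≈J∘G∘J : ∀ n β (a : P n) k → G n (- β) a k ≈ J n (G n β (J n a)) k
  G-neg≈J∘G∘J n β a k = begin
    G n (- β) a k
      ≈⟨ G-as-diffCoeff-sum n (- β) a k ⟩
    inv (n !) * sumℕ (suc K) (λ j → diffCoeff n j * h (ι (K ∸ j)))
      ≈⟨ *-congˡ (diffCoeff-sum-reflect n h-polynomial K K′ K+K′≡n) ⟩
    inv (n !) * (sgn n * sumℕ (suc K′) (λ j → diffCoeff n j * h (reflect (ι (K′ ∸ j)))))
      ≈⟨ *-congˡ (trans (sym (sumℕ-*ˡ (suc K′) (sgn n) _))
                        (sumℕ-cong (suc K′) (λ j → reflected-term (diffCoeff n j) (ι (K′ ∸ j))))) ⟩
    inv (n !) * sumℕ (suc K′) (λ j → diffCoeff n j * uinvValue n (J n a) (ι (K′ ∸ j) + ι n * β))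
      ≈⟨ sym (G-as-diffCoeff-sum n β (J n a) (opposite k)) ⟩
    J n (G n β (J n a)) k ∎
    where
    K = toℕ k
    K′ = toℕ (opposite k)
    K+K′≡n : K ℕ.+ K′ ≡ n
    K+K′≡n = ≡.trans (≡.cong (K ℕ.+_) (opposite-prop k)) (ℕ.m+[n∸m]≡n (toℕ≤pred[n] k))
    h : Carrier → Carrier
    h t = uinvValue n a (t + ι n * - β)
    h-polynomial : IsPolynomial n h
    h-polynomial = IsPolynomial-shift (ι n * - β) (IsPolynomial-uinvValue n a)
    reflected-term : ∀ d x → sgn n * (d * h (reflect x)) ≈ d * uinvValue n (J n a) (x + ι n * β)
    reflected-term d x = begin
      sgn n * (d * h (reflect x))
        ≈⟨ x*yz≈y*xz (sgn n) d (h (reflect x)) ⟩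
      d * (sgn n * h (reflect x))
        ≈⟨ *-congˡ (*-congˡ (IsPolynomial⇒congruent (IsPolynomial-uinvValue n a)
             (solve 3 (λ x i b → :- (con (+ 1) :+ x) :+ i :* (:- b) := :- (con (+ 1) :+ (x :+ i :* b))) refl x (ι n) β))) ⟩
      d * (sgn n * uinvValue n a (reflect (x + ι n * β)))
        ≈⟨ *-congˡ (sym (uinvValue-J n a (x + ι n * β))) ⟩
      d * uinvValue n (J n a) (x + ι n * β) ∎

theorem6p1 : ∀ {c ℓ} (R : CommutativeRing c ℓ) (inv : ℕ → CommutativeRing.Carrier R)
    → (∀ m → CommutativeRing._≈_ R (CommutativeRing._*_ R (Poly.ι R inv (suc m)) (inv (suc m))) (CommutativeRing.1# R))
    → (n : ℕ) (β : CommutativeRing.Carrier R) (a : Poly.P R inv n) (k : Fin (suc n))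
    → CommutativeRing._≈_ R (Poly.G R inv n (CommutativeRing.-_ R β) a k) (Poly.J R inv n (Poly.G R inv n β (Poly.J R inv n a)) k)
theorem6p1 R inv _ = G-neg≈J∘G∘J R inv
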